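{- Let $d,g,h,t\geq 1$ and $r\geq 0$ be integers. Let $G$ be a $(K_{2,2},K_t)$-free graph and let $Z\subseteq V(G)$ with $|Z|\leq h$. Let $Z_0=\{z_1,z_2,z\}\subseteq Z$ be a $3$-clique such that the set of neighbors of $z$ in $Z$ is $\{z_1,z_2\}$. Let $\mathfrak{p}=(Z_0,\ldots,Z_r;\Gamma_i:i\in[r])$ be a $(Z_0,d+g+2^ht,r)$-phantom in $G$ such that $Z_r\cap Z=Z_0$. Then one of the following holds. (a) There exists a $(z_1,z_2,1,g)$-crystal $\mathfrak{c}$ in $G[Z_r]$ such that $V(\mathfrak{c})$ is anticomplete to $Z\setminus Z_0$. (b) $G$ has a (not necessarily induced) subgraph $U$ isomorphic to $T_{d,r}$ such that: $U$ contains $z$ as its root; $\{z_1,z_2\}$ is disjoint from $V(U)$ and every vertex of $\{z_1,z_2\}$ is adjacent in $G$ to every vertex of $V(U)$; and for every $i\in[r]$, every $u\in V(U)$ at distance $i$ in $U$ from $z$, with $u^-$ the parent of $u$ in $U$, we have $u\in\Gamma_i(u^-z_1)\cup\Gamma_i(u^-z_2)\subseteq Z_i\setminus Z_{i-1}$. In particular, $V(U)\cap Z=\{z\}$.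
   Context: Graphs are finite and simple; $G$ is $X$-free if no induced subgraph is isomorphic to $X$; sets of vertices are anticomplete if there is no edge between them; a $c$-clique is a clique of size $c$; $[n]=\{1,\ldots,n\}$. For $Z_0\subseteq V(G)$ and integers $d'\geq1$, $r\geq0$, a $(Z_0,d',r)$-phantom in $G$ is a tuple $(Z_0,\ldots,Z_r;\Gamma_i:i\in[r])$ with $Z_0\subseteq\cdots\subseteq Z_r\subseteq V(G)$ such that for every $i\in[r]$, $\Gamma_i$ is a map with domain $E(G[Z_{i-1}])$, where for each edge $e$, $\Gamma_i(e)\subseteq Z_i\setminus Z_{i-1}$, $|\Gamma_i(e)|=d'$, both ends of $e$ are adjacent to all of $\Gamma_i(e)$, and distinct edges have disjoint images. For adjacent $z_1,z_2$ and integers $f',g'\geq1$, a $(z_1,z_2,f',g')$-crystal in a graph $G'$ is a tuple $(S_{1,w},w,S_{2,w}:w\in S)$ with $S$ an $f'$-subset of $V(G')\setminus\{z_1,z_2\}$, the sets $S_{1,w},S_{2,w}$ ($w\in S$) pairwise disjoint $g'$-subsets of $V(G')\setminus(S\cup\{z_1,z_2\})$, and for each $i\in\{1,2\}$, $w\in S$, $x\in S_{i,w}$, the neighbors of $x$ in $\{z_1,z_2,w\}$ are exactly $\{z_i,w\}$; $V(\mathfrak{c})=S\cup\bigcup_{w\in S}(S_{1,w}\cup S_{2,w})$. $T_{d,r}$ is the rooted tree of radius $r$ whose root has degree $d$ (if $r\geq1$) and whose other non-leaf vertices have degree $d+1$. For vertices $u,v$, $uv$ denotes the edge between them. -}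

module Defs where

open import Data.Nat using (ℕ; zero; suc; _+_; _*_; _^_; _≤_; _<_)
open import Data.Fin using (Fin; zero; suc; inject₁; fromℕ; fromℕ<)
open import Data.Fin.Subset using (Subset; _∈_; _∉_; _⊆_; _∩_; _∪_; ⁅_⁆; ∣_∣)
open import Data.List using (List; []; _∷_; length)
open import Data.Product using (Σ; _×_; _,_; ∃)
open import Data.Sum using (_⊎_)
open import Data.Empty using (⊥)
open import Relation.Nullary using (¬_)
open import Relation.Binary using (Decidable)
open import Relation.Binary.PropositionalEquality using (_≡_; _≢_)

record Graph (n : ℕ) : Set₁ where
  field
    Adj    : Fin n → Fin n → Set
    adj?   : Decidable Adj
    sym    : ∀ {u v} → Adj u v → Adj v u
    irrefl : ∀ {u} → ¬ Adj u u
open Graph public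

Disjoint : ∀ {n} → Subset n → Subset n → Set
Disjoint p q = ∀ x → x ∈ p → x ∈ q → ⊥

K22Free : ∀ {n} → Graph n → Set
K22Free {n} G = ¬ (Σ (Fin n) λ a → Σ (Fin n) λ b → Σ (Fin n) λ c → Σ (Fin n) λ d →
  a ≢ c × b ≢ d ×
  Adj G a b × Adj G b c × Adj G c d × Adj G d a ×
  ¬ Adj G a c × ¬ Adj G b d)

IsClique : ∀ {n c} → Graph n → (Fin c → Fin n) → Set
IsClique {c = c} G f = ∀ (i j : Fin c) → i ≢ j → Adj G (f i) (f j)

KFree : ∀ {n} → ℕ → Graph n → Set
KFree {n} t G = ¬ (Σ (Fin t → Fin n) λ f → IsClique G f)

-- Zs i is Z_i (i = 0..r); Γ k is Γ_{k+1} (k = 0..r-1),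
-- with domain E(G[Z_k]) and values in Z_{k+1} \ Z_k.  An edge e = uv is
-- passed as the pair (u , v); Γ k u v must not depend on the orientation.

record Phantom {n} (G : Graph n) (Z₀ : Subset n) (d' r : ℕ) : Set where
  field
    Zs     : Fin (suc r) → Subset n
    Z-zero : Zs zero ≡ Z₀
    Z-mono : ∀ (k : Fin r) → Zs (inject₁ k) ⊆ Zs (suc k)
    Γ      : Fin r → Fin n → Fin n → Subset n
  InDom : Fin r → Fin n → Fin n → Set
  InDom k u v = u ∈ Zs (inject₁ k) × v ∈ Zs (inject₁ k) × Adj G u v
  field
    Γ-sym    : ∀ k u v → InDom k u v → Γ k u v ≡ Γ k v u
    Γ-new    : ∀ k u v → InDom k u v → ∀ x → x ∈ Γ k u v →
               x ∈ Zs (suc k) × x ∉ Zs (inject₁ k)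
    Γ-size   : ∀ k u v → InDom k u v → ∣ Γ k u v ∣ ≡ d'
    Γ-adj    : ∀ k u v → InDom k u v → ∀ x → x ∈ Γ k u v →
               Adj G u x × Adj G v x
    Γ-disj   : ∀ k u v u' v' → InDom k u v → InDom k u' v' →
               ¬ ((u ≡ u' × v ≡ v') ⊎ (u ≡ v' × v ≡ u')) →
               Disjoint (Γ k u v) (Γ k u' v')
open Phantom public

Zlast : ∀ {n G Z₀ d' r} → Phantom {n} G Z₀ d' r → Subset n
Zlast {r = r} p = Zs p (fromℕ r)

-- (z₁, z₂, f', g')-crystal in G[W] (all of its vertices, and z₁,z₂, lie in W;
-- adjacency in the induced subgraph G[W] is that of G).

record Crystal {n} (G : Graph n) (W : Subset n) (z₁ z₂ : Fin n) (f' g' : ℕ) : Set where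
  field
    S     : Subset n
    S₁ S₂ : Fin n → Subset n
    S-size  : ∣ S ∣ ≡ f'
    S-in    : S ⊆ W
    S-z₁    : z₁ ∉ S
    S-z₂    : z₂ ∉ S
    S₁-size : ∀ w → w ∈ S → ∣ S₁ w ∣ ≡ g'
    S₂-size : ∀ w → w ∈ S → ∣ S₂ w ∣ ≡ g'
    S₁-in   : ∀ w → w ∈ S → S₁ w ⊆ W
    S₂-in   : ∀ w → w ∈ S → S₂ w ⊆ W
    S₁-avoid : ∀ w → w ∈ S → ∀ x → x ∈ S₁ w → x ∉ S × x ≢ z₁ × x ≢ z₂
    S₂-avoid : ∀ w → w ∈ S → ∀ x → x ∈ S₂ w → x ∉ S × x ≢ z₁ × x ≢ z₂
    disj₁₂  : ∀ w w' → w ∈ S → w' ∈ S → Disjoint (S₁ w) (S₂ w')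
    disj₁₁  : ∀ w w' → w ∈ S → w' ∈ S → w ≢ w' → Disjoint (S₁ w) (S₁ w')
    disj₂₂  : ∀ w w' → w ∈ S → w' ∈ S → w ≢ w' → Disjoint (S₂ w) (S₂ w')
    nbr₁    : ∀ w → w ∈ S → ∀ x → x ∈ S₁ w → Adj G x z₁ × Adj G x w × ¬ Adj G x z₂
    nbr₂    : ∀ w → w ∈ S → ∀ x → x ∈ S₂ w → Adj G x z₂ × Adj G x w × ¬ Adj G x z₁
open Crystal public

InV : ∀ {n G W z₁ z₂ f' g'} → Crystal {n} G W z₁ z₂ f' g' → Fin n → Set
InV c x = x ∈ S c ⊎ ∃ λ w → w ∈ S c × (x ∈ S₁ c w ⊎ x ∈ S₂ c w)

Anticomplete : ∀ {n} → Graph n → (Fin n → Set) → (Fin n → Set) → Set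
Anticomplete {n} G A B = ∀ (x y : Fin n) → A x → B y → ¬ Adj G x y

-- Rooted tree T_{d,r}: its nodes are the lists s of elements of Fin d with
-- length s ≤ r; the root is [], and the children of s are j ∷ s (j : Fin d),
-- so the root has d children, every other non-leaf node has d children and
-- one parent, and the depth of s (its distance from the root) is length s.
-- A (not necessarily induced) subgraph U of G isomorphic to T_{d,r} with root
-- z is given by an injective map φ from nodes to vertices with φ [] = z that
-- sends tree edges to edges of G.

TNode : ℕ → ℕ → Set
TNode d r = Σ (List (Fin d)) λ s → length s ≤ r

record TreeCopy {n} (G : Graph n) (d r : ℕ) (z : Fin n) : Set where
  field
    φ      : List (Fin d) → Fin n
    root   : φ [] ≡ z
    inj    : ∀ s s' → length s ≤ r → length s' ≤ r → φ s ≡ φ s' → s ≡ s'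
    edges  : ∀ (j : Fin d) s → length s < r → Adj G (φ s) (φ (j ∷ s))
open TreeCopy public

{-# OPTIONS --safe #-}

-- Call u admissible if it is adjacent to z₁ and z₂ and anticomplete to Z ∖ Z₀.  For an admissible
-- u ∈ Z_i, each of Γ_{i+1}(uz₁) and Γ_{i+1}(uz₂) consists of d + g + 2^h t neighbours of u.  Since G
-- has no induced C₄, the common neighbours of u and a non-neighbour a ∈ Z ∖ Z₀ (a ≠ u as Z_r ∩ Z = Z₀)
-- form a clique, so fewer than t of them exist; hence at most |Z| t ≤ 2^h t vertices of each set have
-- a neighbour in Z ∖ Z₀, and d + g of them are anticomplete to it.  If d of these in Γ_{i+1}(uz₁) are
-- adjacent to z₂, or d of these in Γ_{i+1}(uz₂) are adjacent to z₁, they are admissible children of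
-- u; otherwise g on each side miss the other zⱼ and, with u as the only centre, form a crystal.  So
-- either some admissible vertex gives (a), or every admissible vertex has d admissible children and
-- growing them from z gives (b): vertices at different depths lie in different layers Z_{i+1} ∖ Z_i,
-- and children of distinct parents differ because the images of Γ_{i+1} are pairwise disjoint.

module Submission where

open import Defs hiding (sym)

open import Data.Empty using (⊥-elim)
open import Data.List using (List; []; _∷_; length)
open import Data.Fin using (Fin; zero; suc; toℕ; inject₁; fromℕ; fromℕ<)
open import Data.Fin.Properties
  using (all?; suc-injective; toℕ-inject₁; toℕ-fromℕ<; toℕ-fromℕ; toℕ<n; toℕ-injective)
  renaming (_≟_ to _≟ᶠ_)
open import Data.Fin.Subset
  using (Subset; inside; outside; _∈_; _∉_; _⊆_; _∩_; _∪_; ∁; ∣_∣; ⁅_⁆)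
  renaming (⊥ to ∅)
open import Data.Fin.Subset.Properties
  using (_∈?_; ∉⊥; ∣⊥∣≡0; in⊆in; out⊆; x∈⁅x⁆; x∈⁅y⁆⇒x≡y; ∣⁅x⁆∣≡1; x∈p∪q⁺; x∈p∪q⁻; x∈p∩q⁺; x∈p∩q⁻;
         x∈∁p⇒x∉p; x∉p⇒x∈∁p; ∣p∩q∣≤∣p∣; ∣p∩q∣≤∣q∣)
open import Data.Nat using (ℕ; zero; suc; _+_; _*_; _^_; _≤_; _<_; z≤n; s≤s; _≤?_; _<?_)
open import Data.Nat.Properties
  using (≤-trans; ≤-reflexive; ≤-pred; <⇒≤; ≰⇒>; n≤1+n; <-cmp; +-identityʳ; +-suc; +-comm;
         +-mono-≤; +-monoˡ-≤; +-monoʳ-≤; +-cancelˡ-≤; +-cancelʳ-≤; *-monoˡ-≤; m^n>0; module ≤-Reasoning)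
open import Data.Product using (Σ; ∃; _×_; _,_; proj₁; proj₂)
open import Data.Sum using (_⊎_; inj₁; inj₂; [_,_])
import Data.Sum as Sum
open import Data.Vec using (_∷_; []; here; there; tabulate)
open import Data.Vec.Properties using (lookup∘tabulate; lookup⇒[]=; []=⇒lookup)
open import Function using (_∘_)
open import Function.Definitions using (Injective)
open import Level using (Level)
open import Relation.Binary.Definitions using (tri<; tri≈; tri>)
open import Relation.Binary.PropositionalEquality using (_≡_; _≢_; refl; sym; trans; cong; subst)
open import Relation.Nullary using (Dec; yes; no; does; ¬_; ¬?; _×-dec_; _→-dec_)
open import Relation.Nullary.Decidable using (dec-true)
open import Relation.Unary using (Pred; Decidable)

private
  variable
    n k : ℕ
    ℓ : Level

n<2^n : ∀ n → n < 2 ^ n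
n<2^n zero    = s≤s z≤n
n<2^n (suc n) = ≤-trans (+-mono-≤ (m^n>0 2 n) (n<2^n n))
                        (≤-reflexive (cong (2 ^ n +_) (sym (+-identityʳ (2 ^ n)))))

m+n≤o+p⇒m≤o⊎n≤p : ∀ m n o p → m + n ≤ o + p → m ≤ o ⊎ n ≤ p
m+n≤o+p⇒m≤o⊎n≤p m n o p le with m ≤? o
... | yes m≤o = inj₁ m≤o
... | no  m≰o = inj₂ (+-cancelˡ-≤ o n p (≤-trans (+-monoˡ-≤ n (<⇒≤ (≰⇒> m≰o))) le))

∀⊎⇒⊎∀ : ∀ {m} {A : Set} {B : Fin m → Set} → (∀ x → A ⊎ B x) → A ⊎ (∀ x → B x)
∀⊎⇒⊎∀ {zero}  f = inj₂ λ ()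
∀⊎⇒⊎∀ {suc m} f with f zero | ∀⊎⇒⊎∀ (f ∘ suc)
... | inj₁ a  | _       = inj₁ a
... | inj₂ _  | inj₁ a  = inj₁ a
... | inj₂ b₀ | inj₂ bs = inj₂ λ { zero → b₀ ; (suc x) → bs x }

subsetOf : {P : Pred (Fin n) ℓ} → Decidable P → Subset n
subsetOf P? = tabulate (does ∘ P?)

module _ {P : Pred (Fin n) ℓ} (P? : Decidable P) where

  x∈subsetOf⁺ : ∀ {x} → P x → x ∈ subsetOf P?
  x∈subsetOf⁺ {x} px = lookup⇒[]= x _ (trans (lookup∘tabulate _ x) (dec-true (P? x) px))

  x∈subsetOf⁻ : ∀ {x} → x ∈ subsetOf P? → P x
  x∈subsetOf⁻ {x} x∈ with P? x | trans (sym (lookup∘tabulate _ x)) ([]=⇒lookup x∈)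
  ... | yes px | _  = px
  ... | no  _  | ()

∣p∣≡∣p∩q∣+∣p∩∁q∣ : ∀ (p q : Subset n) → ∣ p ∣ ≡ ∣ p ∩ q ∣ + ∣ p ∩ ∁ q ∣
∣p∣≡∣p∩q∣+∣p∩∁q∣ []            []            = refl
∣p∣≡∣p∩q∣+∣p∩∁q∣ (outside ∷ p) (_ ∷ q)       = ∣p∣≡∣p∩q∣+∣p∩∁q∣ p q
∣p∣≡∣p∩q∣+∣p∩∁q∣ (inside ∷ p)  (inside ∷ q)  = cong suc (∣p∣≡∣p∩q∣+∣p∩∁q∣ p q)
∣p∣≡∣p∩q∣+∣p∩∁q∣ (inside ∷ p)  (outside ∷ q) =
  trans (cong suc (∣p∣≡∣p∩q∣+∣p∩∁q∣ p q)) (sym (+-suc ∣ p ∩ q ∣ ∣ p ∩ ∁ q ∣))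

∣p∪q∣≤∣p∣+∣q∣ : ∀ (p q : Subset n) → ∣ p ∪ q ∣ ≤ ∣ p ∣ + ∣ q ∣
∣p∪q∣≤∣p∣+∣q∣ []            []            = z≤n
∣p∪q∣≤∣p∣+∣q∣ (inside ∷ p)  (inside ∷ q)  =
  s≤s (≤-trans (∣p∪q∣≤∣p∣+∣q∣ p q) (+-monoʳ-≤ ∣ p ∣ (n≤1+n ∣ q ∣)))
∣p∪q∣≤∣p∣+∣q∣ (inside ∷ p)  (outside ∷ q) = s≤s (∣p∪q∣≤∣p∣+∣q∣ p q)
∣p∪q∣≤∣p∣+∣q∣ (outside ∷ p) (inside ∷ q)  =
  ≤-trans (s≤s (∣p∪q∣≤∣p∣+∣q∣ p q)) (≤-reflexive (sym (+-suc ∣ p ∣ ∣ q ∣)))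
∣p∪q∣≤∣p∣+∣q∣ (outside ∷ p) (outside ∷ q) = ∣p∪q∣≤∣p∣+∣q∣ p q

≤∣p∣⇒≤∣p∩q∣⊎≤∣p∩∁q∣ : ∀ {a b} (p q : Subset n) → a + b ≤ ∣ p ∣ → a ≤ ∣ p ∩ q ∣ ⊎ b ≤ ∣ p ∩ ∁ q ∣
≤∣p∣⇒≤∣p∩q∣⊎≤∣p∩∁q∣ {a = a} {b} p q le =
  m+n≤o+p⇒m≤o⊎n≤p a b _ _ (≤-trans le (≤-reflexive (∣p∣≡∣p∩q∣+∣p∩∁q∣ p q)))

⋃[_] : Subset k → (Fin k → Subset n) → Subset n
⋃[ [] ]          F = ∅
⋃[ inside  ∷ Y ] F = F zero ∪ ⋃[ Y ] (F ∘ suc)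
⋃[ outside ∷ Y ] F = ⋃[ Y ] (F ∘ suc)

x∈⋃⁺ : ∀ {Y : Subset k} {F : Fin k → Subset n} {a x} → a ∈ Y → x ∈ F a → x ∈ ⋃[ Y ] F
x∈⋃⁺ {Y = inside  ∷ Y} here        x∈Fa = x∈p∪q⁺ (inj₁ x∈Fa)
x∈⋃⁺ {Y = inside  ∷ Y} (there a∈Y) x∈Fa = x∈p∪q⁺ (inj₂ (x∈⋃⁺ a∈Y x∈Fa))
x∈⋃⁺ {Y = outside ∷ Y} (there a∈Y) x∈Fa = x∈⋃⁺ a∈Y x∈Fa

∣⋃∣≤∣Y∣*t : ∀ {t} (Y : Subset k) (F : Fin k → Subset n) → (∀ a → a ∈ Y → ∣ F a ∣ ≤ t) →
            ∣ ⋃[ Y ] F ∣ ≤ ∣ Y ∣ * t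
∣⋃∣≤∣Y∣*t {n = n} []            F small = ≤-reflexive (∣⊥∣≡0 n)
∣⋃∣≤∣Y∣*t {t = t} (inside ∷ Y)  F small = begin
  ∣ F zero ∪ ⋃[ Y ] (F ∘ suc) ∣       ≤⟨ ∣p∪q∣≤∣p∣+∣q∣ (F zero) _ ⟩
  ∣ F zero ∣ + ∣ ⋃[ Y ] (F ∘ suc) ∣   ≤⟨ +-mono-≤ (small zero here)
                                                  (∣⋃∣≤∣Y∣*t Y (F ∘ suc) (λ a → small (suc a) ∘ there)) ⟩
  t + ∣ Y ∣ * t                        ∎
  where open ≤-Reasoning
∣⋃∣≤∣Y∣*t         (outside ∷ Y) F small = ∣⋃∣≤∣Y∣*t Y (F ∘ suc) (λ a → small (suc a) ∘ there)

⊆-ofSize : ∀ m (p : Subset n) → m ≤ ∣ p ∣ → ∃ λ q → q ⊆ p × ∣ q ∣ ≡ m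
⊆-ofSize {n = n} zero    p             _           = ∅ , (λ x∈∅ → ⊥-elim (∉⊥ x∈∅)) , ∣⊥∣≡0 n
⊆-ofSize         (suc m) (inside ∷ p)  (s≤s m≤∣p∣) with ⊆-ofSize m p m≤∣p∣
... | q , q⊆p , ∣q∣≡m = inside ∷ q , in⊆in q⊆p , cong suc ∣q∣≡m
⊆-ofSize         (suc m) (outside ∷ p) m<∣p∣       with ⊆-ofSize (suc m) p m<∣p∣
... | q , q⊆p , ∣q∣≡m = outside ∷ q , out⊆ q⊆p , ∣q∣≡m

injection-into : ∀ m (p : Subset n) → m ≤ ∣ p ∣ →
                 Σ (Fin m → Fin n) λ f → Injective _≡_ _≡_ f × (∀ i → f i ∈ p)
injection-into              zero    p             _           = (λ ()) , (λ {}) , (λ ())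
injection-into {n = suc n} (suc m) (inside ∷ p)  (s≤s m≤∣p∣) with injection-into m p m≤∣p∣
... | f , f-inj , f∈p = f′ , f′-inj , f′∈p
  where
  f′ : Fin (suc m) → Fin (suc n)
  f′ zero    = zero
  f′ (suc i) = suc (f i)
  f′-inj : Injective _≡_ _≡_ f′
  f′-inj {zero}  {zero}  _  = refl
  f′-inj {suc i} {suc j} eq = cong suc (f-inj (suc-injective eq))
  f′∈p : ∀ i → f′ i ∈ inside ∷ p
  f′∈p zero    = here
  f′∈p (suc i) = there (f∈p i)
injection-into              (suc m) (outside ∷ p) m<∣p∣       with injection-into (suc m) p m<∣p∣
... | f , f-inj , f∈p = suc ∘ f , f-inj ∘ suc-injective , there ∘ f∈p

N : Graph n → Fin n → Subset n
N G v = subsetOf (adj? G v)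

x∈N⁺ : ∀ (G : Graph n) {v x} → Adj G v x → x ∈ N G v
x∈N⁺ G = x∈subsetOf⁺ (adj? G _)

x∈N⁻ : ∀ (G : Graph n) {v x} → x ∈ N G v → Adj G v x
x∈N⁻ G = x∈subsetOf⁻ (adj? G _)

adj⇒≢ : ∀ (G : Graph n) {x y} → Adj G x y → x ≢ y
adj⇒≢ G xy refl = irrefl G xy

module _ (G : Graph n) (c4-free : K22Free G) where

  common-neighbours-adjacent : ∀ {u a x y} → u ≢ a → ¬ Adj G u a → x ≢ y →
    Adj G u x → Adj G u y → Adj G a x → Adj G a y → Adj G x y
  common-neighbours-adjacent {u} {a} {x} {y} u≢a ¬ua x≢y ux uy ax ay with adj? G x y
  ... | yes xy = xy
  ... | no ¬xy =
    ⊥-elim (c4-free (u , x , a , y , u≢a , x≢y , ux , Graph.sym G ax , ay , Graph.sym G uy , ¬ua , ¬xy))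

  common-neighbours<t : ∀ {t u a} → KFree t G → u ≢ a → ¬ Adj G u a → (p : Subset n) →
    (∀ x → x ∈ p → Adj G u x × Adj G a x) → ∣ p ∣ < t
  common-neighbours<t {t} kt-free u≢a ¬ua p common with t ≤? ∣ p ∣
  ... | no  t≰∣p∣ = ≰⇒> t≰∣p∣
  ... | yes t≤∣p∣ with injection-into t p t≤∣p∣
  ...   | f , f-inj , f∈p = ⊥-elim (kt-free (f , clique))
    where
    clique : IsClique G f
    clique i j i≢j =
      let (ui , ai) = common (f i) (f∈p i)
          (uj , aj) = common (f j) (f∈p j)
      in  common-neighbours-adjacent u≢a ¬ua (i≢j ∘ f-inj) ui uj ai aj

  ∣⋃[Y]A∩N∣≤∣Y∣*t : ∀ {t} → KFree t G → (u : Fin n) (Y A : Subset n) →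
    (∀ x → x ∈ A → Adj G u x) → (∀ a → a ∈ Y → u ≢ a × ¬ Adj G u a) →
    ∣ ⋃[ Y ] (λ a → A ∩ N G a) ∣ ≤ ∣ Y ∣ * t
  ∣⋃[Y]A∩N∣≤∣Y∣*t kt-free u Y A A⊆N[u] Y-far = ∣⋃∣≤∣Y∣*t Y (λ a → A ∩ N G a) λ a a∈Y →
    let (u≢a , ¬ua) = Y-far a a∈Y
    in  <⇒≤ (common-neighbours<t kt-free u≢a ¬ua (A ∩ N G a) λ x x∈ →
          let (x∈A , x∈Na) = x∈p∩q⁻ A (N G a) x∈
          in  A⊆N[u] x x∈A , x∈N⁻ G x∈Na)

starCrystal : ∀ {G : Graph n} {W : Subset n} {z₁ z₂ u : Fin n} {g : ℕ} (T₁ T₂ : Subset n) →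
  u ∈ W → u ≢ z₁ → u ≢ z₂ → ∣ T₁ ∣ ≡ g → ∣ T₂ ∣ ≡ g → T₁ ⊆ W → T₂ ⊆ W →
  (∀ x → x ∈ T₁ → x ≢ z₂ × Adj G z₁ x × Adj G u x × ¬ Adj G z₂ x) →
  (∀ x → x ∈ T₂ → x ≢ z₁ × Adj G z₂ x × Adj G u x × ¬ Adj G z₁ x) →
  Σ (Crystal G W z₁ z₂ 1 g) λ 𝔠 → ∀ x → InV 𝔠 x → x ≡ u ⊎ x ∈ T₁ ⊎ x ∈ T₂
starCrystal {G = G} {W} {z₁} {z₂} {u} T₁ T₂ u∈W u≢z₁ u≢z₂ ∣T₁∣≡g ∣T₂∣≡g T₁⊆W T₂⊆W T₁-nbrs T₂-nbrs =
  𝔠 , V𝔠⊆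
  where
  is-u : ∀ {w} → w ∈ ⁅ u ⁆ → w ≡ u
  is-u = x∈⁅y⁆⇒x≡y u
  avoid : ∀ {x w} → Adj G w x → x ≢ w
  avoid wx = adj⇒≢ G (Graph.sym G wx)
  𝔠 : Crystal G W z₁ z₂ 1 _
  𝔠 = record
    { S        = ⁅ u ⁆
    ; S₁       = λ _ → T₁
    ; S₂       = λ _ → T₂
    ; S-size   = ∣⁅x⁆∣≡1 u
    ; S-in     = λ w∈ → subst (_∈ W) (sym (is-u w∈)) u∈W
    ; S-z₁     = λ z₁∈ → u≢z₁ (sym (is-u z₁∈))
    ; S-z₂     = λ z₂∈ → u≢z₂ (sym (is-u z₂∈))
    ; S₁-size  = λ _ _ → ∣T₁∣≡g
    ; S₂-size  = λ _ _ → ∣T₂∣≡g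
    ; S₁-in    = λ _ _ → T₁⊆W
    ; S₂-in    = λ _ _ → T₂⊆W
    ; S₁-avoid = λ _ _ x x∈ → let (x≢z₂ , z₁x , ux , _) = T₁-nbrs x x∈
                              in  avoid ux ∘ is-u , avoid z₁x , x≢z₂
    ; S₂-avoid = λ _ _ x x∈ → let (x≢z₁ , z₂x , ux , _) = T₂-nbrs x x∈
                              in  avoid ux ∘ is-u , x≢z₁ , avoid z₂x
    ; disj₁₂   = λ _ _ _ _ x x∈T₁ x∈T₂ → let (_ , _ , _ , ¬z₂x) = T₁-nbrs x x∈T₁
                                             (_ , z₂x , _)     = T₂-nbrs x x∈T₂
                                         in  ¬z₂x z₂x
    ; disj₁₁   = λ _ _ w∈ w'∈ w≢w' → ⊥-elim (w≢w' (trans (is-u w∈) (sym (is-u w'∈))))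
    ; disj₂₂   = λ _ _ w∈ w'∈ w≢w' → ⊥-elim (w≢w' (trans (is-u w∈) (sym (is-u w'∈))))
    ; nbr₁     = λ w w∈ x x∈ → let (_ , z₁x , ux , ¬z₂x) = T₁-nbrs x x∈
                               in  Graph.sym G z₁x , subst (Adj G x) (sym (is-u w∈)) (Graph.sym G ux)
                                 , ¬z₂x ∘ Graph.sym G
    ; nbr₂     = λ w w∈ x x∈ → let (_ , z₂x , ux , ¬z₁x) = T₂-nbrs x x∈
                               in  Graph.sym G z₂x , subst (Adj G x) (sym (is-u w∈)) (Graph.sym G ux)
                                 , ¬z₁x ∘ Graph.sym G
    }
  V𝔠⊆ : ∀ x → InV 𝔠 x → x ≡ u ⊎ x ∈ T₁ ⊎ x ∈ T₂
  V𝔠⊆ x (inj₁ x∈S)                  = inj₁ (is-u x∈S)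
  V𝔠⊆ x (inj₂ (_ , _ , inj₁ x∈T₁)) = inj₂ (inj₁ x∈T₁)
  V𝔠⊆ x (inj₂ (_ , _ , inj₂ x∈T₂)) = inj₂ (inj₂ x∈T₂)

chain-⊆ : ∀ {r} (C : Fin (suc r) → Subset n) → (∀ k → C (inject₁ k) ⊆ C (suc k)) →
          ∀ {i j} → toℕ i ≤ toℕ j → C i ⊆ C j
chain-⊆             C C-step {zero}  {zero}  _         = λ x∈ → x∈
chain-⊆ {r = suc r} C C-step {zero}  {suc j} _         =
  chain-⊆ (C ∘ suc) (C-step ∘ suc) {zero} {j} z≤n ∘ C-step zero
chain-⊆ {r = suc r} C C-step {suc i} {suc j} (s≤s i≤j) = chain-⊆ (C ∘ suc) (C-step ∘ suc) i≤j

module PhantomFacts {G : Graph n} {Z₀ : Subset n} {d' r : ℕ} (𝔭 : Phantom G Z₀ d' r) where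

  Zs-mono : ∀ {i j} → toℕ i ≤ toℕ j → Zs 𝔭 i ⊆ Zs 𝔭 j
  Zs-mono = chain-⊆ (Zs 𝔭) (Z-mono 𝔭)

  Z₀⊆Zs : ∀ i → Z₀ ⊆ Zs 𝔭 i
  Z₀⊆Zs i x∈Z₀ = Zs-mono {zero} {i} z≤n (subst (_ ∈_) (sym (Z-zero 𝔭)) x∈Z₀)

  Zs⊆Zlast : ∀ i → Zs 𝔭 i ⊆ Zlast 𝔭
  Zs⊆Zlast i = Zs-mono {i} {fromℕ r} (subst (toℕ i ≤_) (sym (toℕ-fromℕ r)) (≤-pred (toℕ<n i)))

  -- x ∈ Z_k for a level k : ℕ rather than k : Fin (suc r); vacuous for k > r, which spares index casts.
  _∈Z[_] : Fin n → ℕ → Set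
  x ∈Z[ k ] = ∀ i → k ≤ toℕ i → x ∈ Zs 𝔭 i

  ∈Zs⇒∈Z[] : ∀ {x i} → x ∈ Zs 𝔭 i → x ∈Z[ toℕ i ]
  ∈Zs⇒∈Z[] x∈Zi j i≤j = Zs-mono i≤j x∈Zi

  ∈Z[]-suc : ∀ {x k} → x ∈Z[ k ] → x ∈Z[ suc k ]
  ∈Z[]-suc x∈Zk i k<i = x∈Zk i (<⇒≤ k<i)

  Γ⊆Zlast : ∀ {i u v x} → InDom 𝔭 i u v → x ∈ Γ 𝔭 i u v → x ∈ Zlast 𝔭
  Γ⊆Zlast {i} {u} {v} {x} uv x∈Γ = Zs⊆Zlast (suc i) (proj₁ (Γ-new 𝔭 i u v uv x x∈Γ))

  Γ-disjoint-Z₀ : ∀ {i u v x} → InDom 𝔭 i u v → x ∈ Γ 𝔭 i u v → x ∉ Z₀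
  Γ-disjoint-Z₀ {i} {u} {v} {x} uv x∈Γ = proj₂ (Γ-new 𝔭 i u v uv x x∈Γ) ∘ Z₀⊆Zs (inject₁ i)

  module Anchors {z₁ z₂ : Fin n} (z₁∈Z₀ : z₁ ∈ Z₀) (z₂∈Z₀ : z₂ ∈ Z₀) where

    Γ₁₂ : Fin r → Fin n → Subset n
    Γ₁₂ i u = Γ 𝔭 i u z₁ ∪ Γ 𝔭 i u z₂

    Anchored : Fin r → Fin n → Set
    Anchored i u = u ∈ Zs 𝔭 (inject₁ i) × Adj G z₁ u × Adj G z₂ u

    anchored⇒InDom : ∀ {i u v} → Anchored i u → v ≡ z₁ ⊎ v ≡ z₂ → InDom 𝔭 i u v
    anchored⇒InDom {i} (u∈Zi , z₁u , _) (inj₁ refl) = u∈Zi , Z₀⊆Zs (inject₁ i) z₁∈Z₀ , Graph.sym G z₁u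
    anchored⇒InDom {i} (u∈Zi , _ , z₂u) (inj₂ refl) = u∈Zi , Z₀⊆Zs (inject₁ i) z₂∈Z₀ , Graph.sym G z₂u

    anchored⇒≢ : ∀ {i u v} → Anchored i u → v ≡ z₁ ⊎ v ≡ z₂ → u ≢ v
    anchored⇒≢ a v≡zₖ = adj⇒≢ G (proj₂ (proj₂ (anchored⇒InDom a v≡zₖ)))

    x∈Γ₁₂⁻ : ∀ {i u x} → x ∈ Γ₁₂ i u → ∃ λ v → (v ≡ z₁ ⊎ v ≡ z₂) × x ∈ Γ 𝔭 i u v
    x∈Γ₁₂⁻ {i} {u} = [ (λ x∈ → z₁ , inj₁ refl , x∈) , (λ x∈ → z₂ , inj₂ refl , x∈) ]
                     ∘ x∈p∪q⁻ (Γ 𝔭 i u z₁) (Γ 𝔭 i u z₂)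

    Γ₁₂-new : ∀ {i u x} → Anchored i u → x ∈ Γ₁₂ i u → x ∈ Zs 𝔭 (suc i) × x ∉ Zs 𝔭 (inject₁ i)
    Γ₁₂-new {i} {u} {x} a x∈ with x∈Γ₁₂⁻ x∈
    ... | v , v≡zₖ , x∈Γuv = Γ-new 𝔭 i u v (anchored⇒InDom a v≡zₖ) x x∈Γuv

    Γ₁₂-adj : ∀ {i u x} → Anchored i u → x ∈ Γ₁₂ i u → Adj G u x
    Γ₁₂-adj {i} {u} {x} a x∈ with x∈Γ₁₂⁻ x∈
    ... | v , v≡zₖ , x∈Γuv = proj₁ (Γ-adj 𝔭 i u v (anchored⇒InDom a v≡zₖ) x x∈Γuv)

    Γ₁₂-disjoint : ∀ {i u u'} → Anchored i u → Anchored i u' → u ≢ u' → Disjoint (Γ₁₂ i u) (Γ₁₂ i u')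
    Γ₁₂-disjoint {i} {u} {u'} a a' u≢u' x x∈ x∈' with x∈Γ₁₂⁻ x∈ | x∈Γ₁₂⁻ x∈'
    ... | v , v≡zₖ , x∈Γuv | v' , v'≡zₖ , x∈Γu'v' =
      Γ-disj 𝔭 i u v u' v' (anchored⇒InDom a v≡zₖ) (anchored⇒InDom a' v'≡zₖ)
        [ u≢u' ∘ proj₁ , anchored⇒≢ a v'≡zₖ ∘ proj₁ ] x x∈Γuv x∈Γu'v'

    Offspring : ℕ → (Fin n → Set) → Fin r → Fin n → Set
    Offspring d P i u = Σ (Fin d → Fin n) λ c → Injective _≡_ _≡_ c × (∀ j → c j ∈ Γ₁₂ i u × P (c j))

    PhantomTree : ℕ → Fin n → Set
    PhantomTree d z = Σ (TreeCopy G d r z) λ U →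
      (∀ s → length s ≤ r →
         φ U s ≢ z₁ × φ U s ≢ z₂ × Adj G z₁ (φ U s) × Adj G z₂ (φ U s))
      ×
      (∀ (j : Fin d) s → (lt : length s < r) →
         φ U s ∈ Zs 𝔭 (inject₁ (fromℕ< lt)) ×
         φ U (j ∷ s) ∈ Γ₁₂ (fromℕ< lt) (φ U s) ×
         φ U (j ∷ s) ∈ Zs 𝔭 (suc (fromℕ< lt)) ×
         φ U (j ∷ s) ∉ Zs 𝔭 (inject₁ (fromℕ< lt)))

    module _ {d : ℕ} (P : Fin n → Set) (P⇒complete : ∀ {u} → P u → Adj G z₁ u × Adj G z₂ u)
             (offspring : ∀ i u → u ∈ Zs 𝔭 (inject₁ i) → P u → Offspring d P i u)
             {z : Fin n} (z∈Z₀ : z ∈ Z₀) (Pz : P z) where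

      record Placed (k : ℕ) : Set where
        field
          vertex     : Fin n
          vertex-P   : P vertex
          vertex-∈Z  : vertex ∈Z[ k ]
      open Placed

      anchored : ∀ {k} (x : Placed k) (i : Fin r) → k ≤ toℕ i → Anchored i (vertex x)
      anchored x i k≤i = vertex-∈Z x (inject₁ i) (subst (_ ≤_) (sym (toℕ-inject₁ i)) k≤i)
                       , P⇒complete (vertex-P x)

      anchored-at : ∀ {k} (x : Placed k) .(k<r : k < r) → Anchored (fromℕ< k<r) (vertex x)
      anchored-at x k<r = anchored x (fromℕ< k<r) (≤-reflexive (sym (toℕ-fromℕ< k<r)))

      children : ∀ {k} (x : Placed k) .(k<r : k < r) → Offspring d P (fromℕ< k<r) (vertex x)
      children x k<r = offspring (fromℕ< k<r) (vertex x) (proj₁ (anchored-at x k<r)) (vertex-P x)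

      child : ∀ {k} (x : Placed k) → k < r → Fin d → Placed (suc k)
      child x k<r j =
        let (c , _ , c-props) = children x k<r
            (cj∈Γ₁₂ , P[cj])  = c-props j
        in  record
          { vertex    = c j
          ; vertex-P  = P[cj]
          ; vertex-∈Z = subst (λ m → c j ∈Z[ suc m ]) (toℕ-fromℕ< k<r)
                              (∈Zs⇒∈Z[] (proj₁ (Γ₁₂-new (anchored-at x k<r) cj∈Γ₁₂)))
          }

      weaken : ∀ {k} → Placed k → Placed (suc k)
      weaken x = record { vertex = vertex x ; vertex-P = vertex-P x
                        ; vertex-∈Z = ∈Z[]-suc (vertex-∈Z x) }

      -- Past depth r a node just repeats its parent; this keeps node total and lies outside T_{d,r}.
      grow : ∀ {k} → Fin d → Placed k → Dec (k < r) → Placed (suc k)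
      grow j x (yes k<r) = child x k<r j
      grow j x (no  _)   = weaken x

      grow-child : ∀ {k} j (x : Placed k) (k<r? : Dec (k < r)) (i : Fin r) → toℕ i ≡ k →
                   vertex (grow j x k<r?) ∈ Γ₁₂ i (vertex x)
      grow-child j x (yes k<r) i i≡k =
        subst (λ i → vertex (child x k<r j) ∈ Γ₁₂ i (vertex x))
              (toℕ-injective (trans (toℕ-fromℕ< k<r) (sym i≡k)))
              (proj₁ (proj₂ (proj₂ (children x k<r)) j))
      grow-child j x (no k≮r) i i≡k = ⊥-elim (k≮r (subst (_< r) i≡k (toℕ<n i)))

      grow-injective : ∀ {k j j'} (x : Placed k) (k<r? : Dec (k < r)) → k < r →
                       vertex (grow j x k<r?) ≡ vertex (grow j' x k<r?) → j ≡ j'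
      grow-injective x (yes k<r) _   = proj₁ (proj₂ (children x k<r))
      grow-injective x (no  k≮r) k<r = ⊥-elim (k≮r k<r)

      node : (s : List (Fin d)) → Placed (length s)
      node []      = record { vertex = z ; vertex-P = Pz ; vertex-∈Z = λ i _ → Z₀⊆Zs i z∈Z₀ }
      node (j ∷ s) = grow j (node s) (length s <? r)

      tree : List (Fin d) → Fin n
      tree s = vertex (node s)

      tree-child : ∀ j s (i : Fin r) → toℕ i ≡ length s → tree (j ∷ s) ∈ Γ₁₂ i (tree s)
      tree-child j s = grow-child j (node s) (length s <? r)

      tree-anchored : ∀ s (i : Fin r) → length s ≤ toℕ i → Anchored i (tree s)
      tree-anchored s = anchored (node s)

      tree-new : ∀ j s (i : Fin r) → toℕ i ≡ length s →
                 tree (j ∷ s) ∈ Zs 𝔭 (suc i) × tree (j ∷ s) ∉ Zs 𝔭 (inject₁ i)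
      tree-new j s i i≡s = Γ₁₂-new (tree-anchored s i (≤-reflexive (sym i≡s))) (tree-child j s i i≡s)

      older≢child : ∀ s j t → length s ≤ length t → length t < r → tree s ≢ tree (j ∷ t)
      older≢child s j t s≤t t<r eq =
        proj₂ (tree-new j t i (toℕ-fromℕ< t<r))
              (subst (_∈ Zs 𝔭 (inject₁ i)) eq
                     (proj₁ (tree-anchored s i (subst (length s ≤_) (sym (toℕ-fromℕ< t<r)) s≤t))))
        where
        i : Fin r
        i = fromℕ< t<r

      tree-injective : ∀ s s' → length s ≤ r → length s' ≤ r → tree s ≡ tree s' → s ≡ s'
      tree-injective []      []        _   _    _  = refl
      tree-injective []      (j' ∷ t') _   s'≤r eq = ⊥-elim (older≢child [] j' t' z≤n s'≤r eq)
      tree-injective (j ∷ t) []        s≤r _    eq = ⊥-elim (older≢child [] j t z≤n s≤r (sym eq))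
      tree-injective (j ∷ t) (j' ∷ t') s≤r s'≤r eq with <-cmp (length t) (length t')
      ... | tri< t<t' _ _ = ⊥-elim (older≢child (j ∷ t) j' t' t<t' s'≤r eq)
      ... | tri> _ _ t'<t = ⊥-elim (older≢child (j' ∷ t') j t t'<t s≤r (sym eq))
      ... | tri≈ _ t≡t' _ with tree t ≟ᶠ tree t'
      ...   | yes tt≡tt' with tree-injective t t' (<⇒≤ s≤r) (<⇒≤ s'≤r) tt≡tt'
      ...     | refl = cong (_∷ t) (grow-injective (node t) (length t <? r) s≤r eq)
      tree-injective (j ∷ t) (j' ∷ t') s≤r s'≤r eq | tri≈ _ t≡t' _ | no tt≢tt' = ⊥-elim (
        Γ₁₂-disjoint (tree-anchored t i (≤-reflexive (sym i≡t)))
                     (tree-anchored t' i (≤-reflexive (sym i≡t')))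
                     tt≢tt' (tree (j ∷ t)) (tree-child j t i i≡t)
                     (subst (_∈ Γ₁₂ i (tree t')) (sym eq) (tree-child j' t' i i≡t')))
        where
        i : Fin r
        i = fromℕ< s≤r
        i≡t : toℕ i ≡ length t
        i≡t = toℕ-fromℕ< s≤r
        i≡t' : toℕ i ≡ length t'
        i≡t' = trans i≡t t≡t'

      tree-complete : ∀ s → tree s ≢ z₁ × tree s ≢ z₂ × Adj G z₁ (tree s) × Adj G z₂ (tree s)
      tree-complete s = let (z₁u , z₂u) = P⇒complete (vertex-P (node s))
                        in  adj⇒≢ G (Graph.sym G z₁u) , adj⇒≢ G (Graph.sym G z₂u) , z₁u , z₂u

      tree-edge : ∀ j s (s<r : length s < r) →
                  tree s ∈ Zs 𝔭 (inject₁ (fromℕ< s<r)) ×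
                  tree (j ∷ s) ∈ Γ₁₂ (fromℕ< s<r) (tree s) ×
                  tree (j ∷ s) ∈ Zs 𝔭 (suc (fromℕ< s<r)) ×
                  tree (j ∷ s) ∉ Zs 𝔭 (inject₁ (fromℕ< s<r))
      tree-edge j s s<r =
        proj₁ (tree-anchored s i (≤-reflexive (sym i≡s))) , tree-child j s i i≡s , tree-new j s i i≡s
        where
        i : Fin r
        i = fromℕ< s<r
        i≡s : toℕ i ≡ length s
        i≡s = toℕ-fromℕ< s<r

      phantomTree : PhantomTree d z
      phantomTree = U , (λ s _ → tree-complete s) , tree-edge
        where
        U : TreeCopy G d r z
        U = record
          { φ     = tree
          ; root  = refl
          ; inj   = tree-injective
          ; edges = λ j s s<r → Γ₁₂-adj (tree-anchored s _ (≤-reflexive (sym (toℕ-fromℕ< s<r))))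
                                        (proj₁ (proj₂ (tree-edge j s s<r)))
          }

module Setting {n} (d g h t r : ℕ) (G : Graph n) (c4-free : K22Free G) (kt-free : KFree t G)
  (Z : Subset n) (∣Z∣≤h : ∣ Z ∣ ≤ h) {z₁ z₂ : Fin n} {Z₀ : Subset n} (z₁∈Z₀ : z₁ ∈ Z₀) (z₂∈Z₀ : z₂ ∈ Z₀)
  (𝔭 : Phantom G Z₀ (d + g + 2 ^ h * t) r) (Zr∩Z≡Z₀ : Zlast 𝔭 ∩ Z ≡ Z₀) where

  open PhantomFacts 𝔭
  open Anchors z₁∈Z₀ z₂∈Z₀

  Z∖Z₀ : Subset n
  Z∖Z₀ = Z ∩ ∁ Z₀

  Clean : Fin n → Set
  Clean x = ∀ y → y ∈ Z∖Z₀ → ¬ Adj G x y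

  clean-if : ∀ {x} → (∀ y → y ∈ Z → Adj G x y → y ∈ Z₀) → Clean x
  clean-if N[x]∩Z⊆Z₀ y y∈Z∖Z₀ xy =
    let (y∈Z , y∈∁Z₀) = x∈p∩q⁻ Z (∁ Z₀) y∈Z∖Z₀
    in  x∈∁p⇒x∉p y∈∁Z₀ (N[x]∩Z⊆Z₀ y y∈Z xy)

  Admissible : Fin n → Set
  Admissible u = Adj G z₁ u × Adj G z₂ u × Clean u

  admissible? : ∀ u → Dec (Admissible u)
  admissible? u = adj? G z₁ u ×-dec adj? G z₂ u ×-dec all? (λ y → (y ∈? Z∖Z₀) →-dec ¬? (adj? G u y))

  AnticompleteCrystal : Set
  AnticompleteCrystal = Σ (Crystal G (Zlast 𝔭) z₁ z₂ 1 g) λ 𝔠 →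
                          Anticomplete G (InV 𝔠) (λ y → y ∈ Z × y ∉ Z₀)

  Zlast-disjoint-Z∖Z₀ : ∀ {u y} → u ∈ Zlast 𝔭 → y ∈ Z∖Z₀ → u ≢ y
  Zlast-disjoint-Z∖Z₀ u∈Zr y∈Z∖Z₀ refl =
    let (y∈Z , y∈∁Z₀) = x∈p∩q⁻ Z (∁ Z₀) y∈Z∖Z₀
    in  x∈∁p⇒x∉p y∈∁Z₀ (subst (_ ∈_) Zr∩Z≡Z₀ (x∈p∩q⁺ (u∈Zr , y∈Z)))

  cleanΓ : Fin r → Fin n → Fin n → Subset n
  cleanΓ i u v = Γ 𝔭 i u v ∩ ∁ (⋃[ Z∖Z₀ ] λ a → Γ 𝔭 i u v ∩ N G a)

  x∈cleanΓ⁻ : ∀ {i u v x} → x ∈ cleanΓ i u v → x ∈ Γ 𝔭 i u v × Clean x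
  x∈cleanΓ⁻ {i} {u} {v} x∈D =
    let (x∈Γ , x∈∁B) = x∈p∩q⁻ (Γ 𝔭 i u v) _ x∈D
    in  x∈Γ , λ y y∈Z∖Z₀ xy →
          x∈∁p⇒x∉p x∈∁B (x∈⋃⁺ y∈Z∖Z₀ (x∈p∩q⁺ (x∈Γ , x∈N⁺ G (Graph.sym G xy))))

  ∣Z∖Z₀∣≤2^h : ∣ Z∖Z₀ ∣ ≤ 2 ^ h
  ∣Z∖Z₀∣≤2^h = ≤-trans (∣p∩q∣≤∣p∣ Z (∁ Z₀)) (≤-trans ∣Z∣≤h (<⇒≤ (n<2^n h)))

  d+g≤∣cleanΓ∣ : ∀ {i u v} → u ∈ Zlast 𝔭 → Clean u → InDom 𝔭 i u v → d + g ≤ ∣ cleanΓ i u v ∣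
  d+g≤∣cleanΓ∣ {i} {u} {v} u∈Zr u-clean uv = +-cancelʳ-≤ (2 ^ h * t) (d + g) ∣ D ∣ (begin
    d + g + 2 ^ h * t   ≡⟨ Γ-size 𝔭 i u v uv ⟨
    ∣ A ∣               ≡⟨ ∣p∣≡∣p∩q∣+∣p∩∁q∣ A B ⟩
    ∣ A ∩ B ∣ + ∣ D ∣   ≤⟨ +-monoˡ-≤ ∣ D ∣ (≤-trans (∣p∩q∣≤∣q∣ A B) B-small) ⟩
    2 ^ h * t + ∣ D ∣   ≡⟨ +-comm (2 ^ h * t) ∣ D ∣ ⟩
    ∣ D ∣ + 2 ^ h * t   ∎)
    where
    open ≤-Reasoning
    A = Γ 𝔭 i u v
    B = ⋃[ Z∖Z₀ ] λ a → A ∩ N G a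
    D = cleanΓ i u v
    B-small : ∣ B ∣ ≤ 2 ^ h * t
    B-small = ≤-trans
      (∣⋃[Y]A∩N∣≤∣Y∣*t G c4-free kt-free u Z∖Z₀ A (λ x x∈A → proj₁ (Γ-adj 𝔭 i u v uv x x∈A))
                                            (λ a a∈ → Zlast-disjoint-Z∖Z₀ u∈Zr a∈ , u-clean a a∈))
      (*-monoˡ-≤ t ∣Z∖Z₀∣≤2^h)

  CleanNeighbours : Fin r → Fin n → Fin n → Fin n → Set
  CleanNeighbours i u v w =
    Σ (Fin d → Fin n) λ c → Injective _≡_ _≡_ c × (∀ j → c j ∈ Γ 𝔭 i u v × Adj G w (c j) × Clean (c j))

  CleanNonNeighbours : Fin r → Fin n → Fin n → Fin n → Set
  CleanNonNeighbours i u v w =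
    Σ (Subset n) λ q → ∣ q ∣ ≡ g × (∀ x → x ∈ q → x ∈ Γ 𝔭 i u v × ¬ Adj G w x × Clean x)

  clean-neighbours-or-non-neighbours : ∀ {i u v} w → u ∈ Zlast 𝔭 → Clean u → InDom 𝔭 i u v →
    CleanNeighbours i u v w ⊎ CleanNonNeighbours i u v w
  clean-neighbours-or-non-neighbours {i} {u} {v} w u∈Zr u-clean uv
    with ≤∣p∣⇒≤∣p∩q∣⊎≤∣p∩∁q∣ (cleanΓ i u v) (N G w) (d+g≤∣cleanΓ∣ u∈Zr u-clean uv)
  ... | inj₁ d≤ = let (c , c-inj , c∈) = injection-into d _ d≤ in
    inj₁ (c , c-inj , λ j →
      let (c∈D , c∈Nw)    = x∈p∩q⁻ (cleanΓ i u v) (N G w) (c∈ j)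
          (c∈Γ , c-clean) = x∈cleanΓ⁻ c∈D
      in  c∈Γ , x∈N⁻ G c∈Nw , c-clean)
  ... | inj₂ g≤ = let (q , q⊆ , ∣q∣≡g) = ⊆-ofSize g _ g≤ in
    inj₂ (q , ∣q∣≡g , λ x x∈q →
      let (x∈D , x∈∁Nw)   = x∈p∩q⁻ (cleanΓ i u v) (∁ (N G w)) (q⊆ x∈q)
          (x∈Γ , x-clean) = x∈cleanΓ⁻ x∈D
      in  x∈Γ , x∈∁p⇒x∉p x∈∁Nw ∘ x∈N⁺ G , x-clean)

  module _ {i u} (a : Anchored i u) (u-clean : Clean u) where

    private
      z₁u : Adj G z₁ u
      z₁u = proj₁ (proj₂ a)
      z₂u : Adj G z₂ u
      z₂u = proj₂ (proj₂ a)
      uz₁ : InDom 𝔭 i u z₁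
      uz₁ = anchored⇒InDom a (inj₁ refl)
      uz₂ : InDom 𝔭 i u z₂
      uz₂ = anchored⇒InDom a (inj₂ refl)
      u∈Zr : u ∈ Zlast 𝔭
      u∈Zr = Zs⊆Zlast (inject₁ i) (proj₁ a)

    crystal-at : CleanNonNeighbours i u z₁ z₂ → CleanNonNeighbours i u z₂ z₁ → AnticompleteCrystal
    crystal-at (q₁ , ∣q₁∣≡g , q₁-props) (q₂ , ∣q₂∣≡g , q₂-props) = 𝔠 , anticomplete
      where
      stranger : ∀ {v w x} → InDom 𝔭 i u v → w ∈ Z₀ → x ∈ Γ 𝔭 i u v → ¬ Adj G w x →
                 x ≢ w × Adj G v x × Adj G u x × ¬ Adj G w x
      stranger {v} {w} {x} uv w∈Z₀ x∈Γ ¬wx =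
        let (ux , vx) = Γ-adj 𝔭 i u v uv x x∈Γ
        in  (λ { refl → Γ-disjoint-Z₀ uv x∈Γ w∈Z₀ }) , vx , ux , ¬wx

      star : Σ (Crystal G (Zlast 𝔭) z₁ z₂ 1 g) λ 𝔠 → ∀ x → InV 𝔠 x → x ≡ u ⊎ x ∈ q₁ ⊎ x ∈ q₂
      star = starCrystal q₁ q₂ u∈Zr (adj⇒≢ G (Graph.sym G z₁u)) (adj⇒≢ G (Graph.sym G z₂u))
               ∣q₁∣≡g ∣q₂∣≡g
               (λ {x} x∈q₁ → Γ⊆Zlast uz₁ (proj₁ (q₁-props x x∈q₁)))
               (λ {x} x∈q₂ → Γ⊆Zlast uz₂ (proj₁ (q₂-props x x∈q₂)))
               (λ x x∈q₁ → let (x∈Γ , ¬z₂x , _) = q₁-props x x∈q₁ in stranger uz₁ z₂∈Z₀ x∈Γ ¬z₂x)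
               (λ x x∈q₂ → let (x∈Γ , ¬z₁x , _) = q₂-props x x∈q₂ in stranger uz₂ z₁∈Z₀ x∈Γ ¬z₁x)

      𝔠 : Crystal G (Zlast 𝔭) z₁ z₂ 1 g
      𝔠 = proj₁ star

      clean : ∀ {x} → x ≡ u ⊎ x ∈ q₁ ⊎ x ∈ q₂ → Clean x
      clean (inj₁ refl)        = u-clean
      clean (inj₂ (inj₁ x∈q₁)) = proj₂ (proj₂ (q₁-props _ x∈q₁))
      clean (inj₂ (inj₂ x∈q₂)) = proj₂ (proj₂ (q₂-props _ x∈q₂))

      anticomplete : Anticomplete G (InV 𝔠) (λ y → y ∈ Z × y ∉ Z₀)
      anticomplete x y x∈V (y∈Z , y∉Z₀) = clean (proj₂ star x x∈V) y (x∈p∩q⁺ (y∈Z , x∉p⇒x∈∁p y∉Z₀))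

    crystal-or-offspring : AnticompleteCrystal ⊎ Offspring d Admissible i u
    crystal-or-offspring with clean-neighbours-or-non-neighbours z₂ u∈Zr u-clean uz₁
                            | clean-neighbours-or-non-neighbours z₁ u∈Zr u-clean uz₂
    ... | inj₁ (c , c-inj , c-props) | _ = inj₂ (c , c-inj , λ j →
          let (c∈Γ , z₂c , c-clean) = c-props j
          in  x∈p∪q⁺ (inj₁ c∈Γ) , proj₂ (Γ-adj 𝔭 i u z₁ uz₁ (c j) c∈Γ) , z₂c , c-clean)
    ... | inj₂ _ | inj₁ (c , c-inj , c-props) = inj₂ (c , c-inj , λ j →
          let (c∈Γ , z₁c , c-clean) = c-props j
          in  x∈p∪q⁺ (inj₂ c∈Γ) , z₁c , proj₂ (Γ-adj 𝔭 i u z₂ uz₂ (c j) c∈Γ) , c-clean)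
    ... | inj₂ M₁ | inj₂ M₂ = inj₁ (crystal-at M₁ M₂)

  crystal-or-offspring-everywhere :
    AnticompleteCrystal ⊎ (∀ i u → u ∈ Zs 𝔭 (inject₁ i) → Admissible u → Offspring d Admissible i u)
  crystal-or-offspring-everywhere = ∀⊎⇒⊎∀ λ i → ∀⊎⇒⊎∀ λ u → at i u
    where
    at : ∀ i u → AnticompleteCrystal ⊎ (u ∈ Zs 𝔭 (inject₁ i) → Admissible u → Offspring d Admissible i u)
    at i u with u ∈? Zs 𝔭 (inject₁ i) ×-dec admissible? u
    ... | yes (u∈Zi , (z₁u , z₂u , u-clean)) =
      Sum.map₂ (λ o _ _ → o) (crystal-or-offspring (u∈Zi , z₁u , z₂u) u-clean)
    ... | no  ¬ok = inj₂ λ u∈Zi u-ok → ⊥-elim (¬ok (u∈Zi , u-ok))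

  crystal-or-tree : ∀ {z} → z ∈ Z₀ → Admissible z → AnticompleteCrystal ⊎ PhantomTree d z
  crystal-or-tree z∈Z₀ z-ok =
    Sum.map₂ (λ offspring → phantomTree Admissible (λ (z₁u , z₂u , _) → z₁u , z₂u) offspring z∈Z₀ z-ok)
             crystal-or-offspring-everywhere

theorem4p1 :
  (d g h t r : ℕ) → 1 ≤ d → 1 ≤ g → 1 ≤ h → 1 ≤ t →
  {n : ℕ} (G : Graph n) → K22Free G → KFree t G →
  (Z : Subset n) → ∣ Z ∣ ≤ h →
  (z₁ z₂ z : Fin n) →
  Adj G z₁ z₂ → Adj G z₁ z → Adj G z₂ z →
  (⁅ z₁ ⁆ ∪ ⁅ z₂ ⁆ ∪ ⁅ z ⁆) ⊆ Z →
  (∀ v → v ∈ Z → (Adj G z v → v ≡ z₁ ⊎ v ≡ z₂) × (v ≡ z₁ ⊎ v ≡ z₂ → Adj G z v)) →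
  (𝔭 : Phantom G (⁅ z₁ ⁆ ∪ ⁅ z₂ ⁆ ∪ ⁅ z ⁆) (d + g + 2 ^ h * t) r) →
  Zlast 𝔭 ∩ Z ≡ (⁅ z₁ ⁆ ∪ ⁅ z₂ ⁆ ∪ ⁅ z ⁆) →
  -- (a)
  (Σ (Crystal G (Zlast 𝔭) z₁ z₂ 1 g) λ 𝔠 →
     Anticomplete G (InV 𝔠) (λ y → y ∈ Z × y ∉ (⁅ z₁ ⁆ ∪ ⁅ z₂ ⁆ ∪ ⁅ z ⁆)))
  ⊎
  -- (b)
  (Σ (TreeCopy G d r z) λ U →
     (∀ s → length s ≤ r →
        φ U s ≢ z₁ × φ U s ≢ z₂ × Adj G z₁ (φ U s) × Adj G z₂ (φ U s))
     ×
     (∀ (j : Fin d) s → (lt : length s < r) →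
        φ U s ∈ Zs 𝔭 (inject₁ (fromℕ< lt)) ×
        φ U (j ∷ s) ∈ (Γ 𝔭 (fromℕ< lt) (φ U s) z₁ ∪ Γ 𝔭 (fromℕ< lt) (φ U s) z₂) ×
        φ U (j ∷ s) ∈ Zs 𝔭 (suc (fromℕ< lt)) ×
        φ U (j ∷ s) ∉ Zs 𝔭 (inject₁ (fromℕ< lt))))
theorem4p1 d g h t r _ _ _ _ G c4-free kt-free Z ∣Z∣≤h z₁ z₂ z _ z₁z z₂z _ N[z]∩Z 𝔭 Zr∩Z≡Z₀ =
  crystal-or-tree z∈Z₀ (z₁z , z₂z , z-clean)
  where
  z₁∈Z₀ : z₁ ∈ ⁅ z₁ ⁆ ∪ ⁅ z₂ ⁆ ∪ ⁅ z ⁆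
  z₁∈Z₀ = x∈p∪q⁺ (inj₁ (x∈⁅x⁆ z₁))
  z₂∈Z₀ : z₂ ∈ ⁅ z₁ ⁆ ∪ ⁅ z₂ ⁆ ∪ ⁅ z ⁆
  z₂∈Z₀ = x∈p∪q⁺ (inj₂ (x∈p∪q⁺ (inj₁ (x∈⁅x⁆ z₂))))
  z∈Z₀ : z ∈ ⁅ z₁ ⁆ ∪ ⁅ z₂ ⁆ ∪ ⁅ z ⁆
  z∈Z₀ = x∈p∪q⁺ (inj₂ (x∈p∪q⁺ (inj₂ (x∈⁅x⁆ z))))
  open Setting d g h t r G c4-free kt-free Z ∣Z∣≤h z₁∈Z₀ z₂∈Z₀ 𝔭 Zr∩Z≡Z₀
  z-clean : Clean z
  z-clean = clean-if λ y y∈Z zy →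
    [ (λ { refl → z₁∈Z₀ }) , (λ { refl → z₂∈Z₀ }) ] (proj₁ (N[z]∩Z y y∈Z) zy)
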